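{- Let $G$ be a connected graph on $n$ vertices. Then $$SW_3(G) \geq \frac{n-2}{2}\, W(G),$$ with equality if and only if $G$ is a modular graph.
   Context: For a connected graph $G$ and $u,v\in V(G)$, $d(u,v)$ is the number of edges of a shortest $u,v$-path. The Wiener index is $W(G)=\sum_{\{u,v\}\subseteq V(G)} d(u,v)$ (sum over unordered pairs of distinct vertices). For $S\subseteq V(G)$, the Steiner distance $d(S)$ is the minimum number of edges of a connected subgraph of $G$ containing all vertices of $S$. The Steiner $3$-Wiener index is $SW_3(G)=\sum_{S\subseteq V(G),\,|S|=3} d(S)$. The interval $I(u,v)$ is the set of all vertices lying on some shortest $u,v$-path. A connected graph $G$ is modular if for every three vertices $x,y,z$ one has $I(x,y)\cap I(x,z)\cap I(y,z)\neq\emptyset$. -}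

module Defs where

open import Data.Nat using (ℕ; zero; suc; _+_; _≤_)
open import Data.Fin using (Fin; zero; suc; _<?_)
open import Data.Bool using (Bool; true; false; T; if_then_else_)
open import Data.Product using (Σ; ∃; _×_)
open import Data.Sum using (_⊎_)
open import Relation.Binary.PropositionalEquality using (_≡_)
open import Relation.Nullary.Decidable using (does)

record Graph (n : ℕ) : Set where
  field
    adj    : Fin n → Fin n → Bool
    sym    : ∀ u v → adj u v ≡ adj v u
    irrefl : ∀ u → adj u u ≡ false
open Graph public

data Walk {n : ℕ} (A : Fin n → Fin n → Bool) : Fin n → Fin n → ℕ → Set where
  [] : ∀ {u} → Walk A u u 0
  _∷_ : ∀ {u v w k} → T (A u v) → Walk A v w k → Walk A u w (suc k)

data OnWalk {n : ℕ} {A : Fin n → Fin n → Bool} (m : Fin n) :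
       ∀ {u v k} → Walk A u v k → Set where
  here  : ∀ {v k} (w : Walk A m v k) → OnWalk m w
  there : ∀ {u x v k} (e : T (A u x)) (w : Walk A x v k) → OnWalk m w → OnWalk m (e ∷ w)

Connected : ∀ {n} → Graph n → Set
Connected G = ∀ u v → ∃ λ k → Walk (adj G) u v k

IsDist : ∀ {n} → Graph n → Fin n → Fin n → ℕ → Set
IsDist G u v k = Walk (adj G) u v k × (∀ k' → Walk (adj G) u v k' → k ≤ k')

sumFin : (n : ℕ) → (Fin n → ℕ) → ℕ
sumFin zero f = 0
sumFin (suc n) f = f zero + sumFin n (λ i → f (suc i))

sumPairs : (n : ℕ) → (Fin n → Fin n → ℕ) → ℕ
sumPairs n f = sumFin n λ i → sumFin n λ j → if does (i <? j) then f i j else 0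

sumTriples : (n : ℕ) → (Fin n → Fin n → Fin n → ℕ) → ℕ
sumTriples n f = sumFin n λ i → sumFin n λ j → sumFin n λ k →
  if does (i <? j) then (if does (j <? k) then f i j k else 0) else 0

record Subgraph {n : ℕ} (G : Graph n) : Set where
  field
    vs     : Fin n → Bool
    es     : Fin n → Fin n → Bool
    es-sym : ∀ u v → es u v ≡ es v u
    es-sub : ∀ u v → T (es u v) → T (adj G u v)
    es-end : ∀ u v → T (es u v) → T (vs u)
open Subgraph public

SubConnected : ∀ {n} {G : Graph n} → Subgraph G → Set
SubConnected H = ∀ u v → T (vs H u) → T (vs H v) → ∃ λ k → Walk (es H) u v k

edgeCount : ∀ {n} {G : Graph n} → Subgraph G → ℕ
edgeCount {n} H = sumPairs n λ i j → if es H i j then 1 else 0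

ContainsTriple : ∀ {n} {G : Graph n} → Subgraph G → Fin n → Fin n → Fin n → Set
ContainsTriple H x y z = T (vs H x) × T (vs H y) × T (vs H z)

IsSteinerDist : ∀ {n} → Graph n → Fin n → Fin n → Fin n → ℕ → Set
IsSteinerDist G x y z k =
  (Σ (Subgraph G) λ H → SubConnected H × ContainsTriple H x y z × edgeCount H ≡ k)
  × (∀ (H : Subgraph G) → SubConnected H → ContainsTriple H x y z → k ≤ edgeCount H)

Wiener : (n : ℕ) → (Fin n → Fin n → ℕ) → ℕ
Wiener n d = sumPairs n d

SteinerWiener3 : (n : ℕ) → (Fin n → Fin n → Fin n → ℕ) → ℕ
SteinerWiener3 n sd = sumTriples n sd

InInterval : ∀ {n} → Graph n → Fin n → Fin n → Fin n → Set
InInterval G u v m =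
  Σ ℕ λ k → Σ (Walk (adj G) u v k) λ w →
    OnWalk m w × (∀ k' → Walk (adj G) u v k' → k ≤ k')

Modular : ∀ {n} → Graph n → Set
Modular {n} G = ∀ (x y z : Fin n) → ∃ λ m →
  InInterval G x y m × InInterval G x z m × InInterval G y z m

-- Pointwise, d(x,y) + d(y,z) + d(x,z) ≤ 2 d({x,y,z}). A connected subgraph H containing x, y, z
-- contains a path P from x to y and a path Q from z to the first vertex c of P that it meets; P and
-- Q share no edge, so H has at least d(x,c) + d(y,c) + d(z,c) edges, and each of d(x,y), d(y,z),
-- d(x,z) is at most the sum of two of these three legs. Equality forces the three triangle
-- inequalities through c to be tight, i.e. c lies in all three intervals; conversely, for a common
-- vertex m of the intervals, the union of geodesics from x, y, z to m is a connected subgraph with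
-- at most d(x,m) + d(y,m) + d(z,m) edges, which makes the pointwise bound an equality. Every pair of vertices
-- lies in exactly n − 2 triples, so summing the pointwise bound gives (n − 2) W ≤ 2 SW₃, with
-- equality iff it holds for every triple, i.e. iff G is modular.

module Submission where

open import Defs hiding (sym)
open import Data.Bool using (Bool; true; false; T; if_then_else_; _∧_; _∨_)
open import Data.Bool.Properties using (if-eta; T-∨; ∨-comm; ∧-comm; ∨-assoc; ∨-identityʳ)
open import Data.Empty using (⊥; ⊥-elim)
open import Data.Fin using (Fin; zero; suc; _<_; _<?_; _≟_)
open import Data.Fin.Properties using (<-cmp; <-irrefl)
open import Data.Nat using (ℕ; zero; suc; _+_; _*_; _∸_; _≤_; z≤n; s≤s)
open import Data.Nat.Properties
  using ( ≤-refl; ≤-reflexive; ≤-trans; ≤-antisym; n≤0⇒n≡0; +-comm; +-assoc; +-identityʳ; *-zeroʳ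
        ; *-distribˡ-+; +-mono-≤; +-monoˡ-≤; +-monoʳ-≤; *-monoʳ-≤; +-cancelˡ-≤; +-cancelʳ-≤; module ≤-Reasoning)
open import Data.Nat.Tactic.RingSolver using (solve-∀)
open import Data.Product using (Σ; ∃; _×_; _,_; proj₁; proj₂)
open import Data.Sum using (_⊎_; inj₁; inj₂; [_,_])
open import Data.Unit using (⊤; tt)
open import Function using (_∘_; Equivalence; _⇔_; mk⇔)
open import Relation.Binary.Definitions using (tri<; tri≈; tri>)
open import Relation.Binary.PropositionalEquality
  using (_≡_; _≢_; refl; sym; trans; cong; cong₂; subst; module ≡-Reasoning)
open import Relation.Nullary using (¬_; Dec; yes; no)
open import Relation.Nullary.Decidable using (does; isYes; dec-true; dec-false; toWitness; fromWitness)

-- Finite sums over Fin n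

+-mono-≤-tight : ∀ {a b c d} → a ≤ b → c ≤ d → a + c ≡ b + d → a ≡ b × c ≡ d
+-mono-≤-tight {a} {b} {c} {d} a≤b c≤d eq = ≤-antisym a≤b b≤a , ≤-antisym c≤d d≤c
  where
  b≤a : b ≤ a
  b≤a = +-cancelʳ-≤ d b a (≤-trans (≤-reflexive (sym eq)) (+-monoʳ-≤ a c≤d))
  d≤c : d ≤ c
  d≤c = +-cancelˡ-≤ b d c (≤-trans (≤-reflexive (sym eq)) (+-monoˡ-≤ c a≤b))

if-mono : ∀ b {x y} → x ≤ y → (if b then x else 0) ≤ (if b then y else 0)
if-mono true  x≤y = x≤y
if-mono false _   = z≤n

if-+ : ∀ b x y → (if b then x + y else 0) ≡ (if b then x else 0) + (if b then y else 0)
if-+ true  x y = refl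
if-+ false x y = refl

if-* : ∀ b c x → (if b then c * x else 0) ≡ c * (if b then x else 0)
if-* true  c x = refl
if-* false c x = sym (*-zeroʳ c)

sumFin-cong : ∀ n {f g : Fin n → ℕ} → (∀ i → f i ≡ g i) → sumFin n f ≡ sumFin n g
sumFin-cong zero    f≗g = refl
sumFin-cong (suc n) f≗g = cong₂ _+_ (f≗g zero) (sumFin-cong n (f≗g ∘ suc))

sumFin-mono : ∀ n {f g : Fin n → ℕ} → (∀ i → f i ≤ g i) → sumFin n f ≤ sumFin n g
sumFin-mono zero    f≤g = z≤n
sumFin-mono (suc n) f≤g = +-mono-≤ (f≤g zero) (sumFin-mono n (f≤g ∘ suc))

sumFin-+ : ∀ n (f g : Fin n → ℕ) → sumFin n (λ i → f i + g i) ≡ sumFin n f + sumFin n g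
sumFin-+ zero    f g = refl
sumFin-+ (suc n) f g =
  trans (cong (f zero + g zero +_) (sumFin-+ n (f ∘ suc) (g ∘ suc))) (+-assoc-swap (f zero) (g zero) _ _)
  where
  +-assoc-swap : ∀ a b c d → a + b + (c + d) ≡ a + c + (b + d)
  +-assoc-swap = solve-∀

sumFin-* : ∀ n c (f : Fin n → ℕ) → sumFin n (λ i → c * f i) ≡ c * sumFin n f
sumFin-* zero    c f = sym (*-zeroʳ c)
sumFin-* (suc n) c f = trans (cong (c * f zero +_) (sumFin-* n c (f ∘ suc))) (sym (*-distribˡ-+ c _ _))

sumFin-const : ∀ n c → sumFin n (λ _ → c) ≡ n * c
sumFin-const zero    c = refl
sumFin-const (suc n) c = cong (c +_) (sumFin-const n c)

sumFin-zero : ∀ n → sumFin n (λ _ → 0) ≡ 0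
sumFin-zero zero    = refl
sumFin-zero (suc n) = sumFin-zero n

sumFin-δ : ∀ n (a : Fin n) (g : Fin n → ℕ) → sumFin n (λ i → if does (i ≟ a) then g i else 0) ≡ g a
sumFin-δ (suc n) zero    g = trans (cong (g zero +_) (sumFin-zero n)) (+-identityʳ (g zero))
sumFin-δ (suc n) (suc a) g = sumFin-δ n a (g ∘ suc)

sumFin-tight : ∀ n {f g : Fin n → ℕ} → (∀ i → f i ≤ g i) → sumFin n f ≡ sumFin n g → ∀ i → f i ≡ g i
sumFin-tight (suc n) f≤g eq zero    = proj₁ (+-mono-≤-tight (f≤g zero) (sumFin-mono n (f≤g ∘ suc)) eq)
sumFin-tight (suc n) f≤g eq (suc i) =
  sumFin-tight n (f≤g ∘ suc) (proj₂ (+-mono-≤-tight (f≤g zero) (sumFin-mono n (f≤g ∘ suc)) eq)) i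

-- At n = 0 this holds only because the sum is empty (0 ∸ 1 = 0).
sumFin-+-pred : ∀ n (f : Fin n → ℕ) → sumFin n f + (n ∸ 1) * sumFin n f ≡ n * sumFin n f
sumFin-+-pred zero    f = refl
sumFin-+-pred (suc n) f = refl

sumPairs-mono : ∀ n {f g : Fin n → Fin n → ℕ} → (∀ i j → f i j ≤ g i j) → sumPairs n f ≤ sumPairs n g
sumPairs-mono n f≤g = sumFin-mono n λ i → sumFin-mono n λ j → if-mono (does (i <? j)) (f≤g i j)

sumPairs-cong : ∀ n {f g : Fin n → Fin n → ℕ} → (∀ i j → f i j ≡ g i j) → sumPairs n f ≡ sumPairs n g
sumPairs-cong n f≗g = sumFin-cong n λ i → sumFin-cong n λ j → cong (λ t → if does (i <? j) then t else 0) (f≗g i j)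

sumPairs-+ : ∀ n (f g : Fin n → Fin n → ℕ) →
  sumPairs n (λ i j → f i j + g i j) ≡ sumPairs n f + sumPairs n g
sumPairs-+ n f g = trans
  (sumFin-cong n λ i → trans (sumFin-cong n λ j → if-+ (does (i <? j)) (f i j) (g i j)) (sumFin-+ n _ _))
  (sumFin-+ n _ _)

sumPairs-suc : ∀ n (f : Fin (suc n) → Fin (suc n) → ℕ) →
  sumPairs (suc n) f ≡ sumFin n (λ j → f zero (suc j)) + sumPairs n (λ i j → f (suc i) (suc j))
sumPairs-suc n f = refl

-- At n ≤ 1 this holds only because there are no pairs.
sumPairs-+-pred : ∀ n (f : Fin n → Fin n → ℕ) → sumPairs n f + (n ∸ 2) * sumPairs n f ≡ (n ∸ 1) * sumPairs n f
sumPairs-+-pred zero          f = refl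
sumPairs-+-pred (suc zero)    f = refl
sumPairs-+-pred (suc (suc n)) f = refl

sumPairs-ends : ∀ n (h : Fin n → ℕ) → sumPairs n (λ j k → h j + h k) ≡ (n ∸ 1) * sumFin n h
sumPairs-ends zero    h = refl
sumPairs-ends (suc n) h = begin
    sumPairs (suc n) (λ j k → h j + h k)
  ≡⟨ sumPairs-suc n (λ j k → h j + h k) ⟩
    sumFin n (λ k → h zero + h (suc k)) + sumPairs n (λ j k → h (suc j) + h (suc k))
  ≡⟨ cong₂ _+_ (trans (sumFin-+ n _ _) (cong (_+ S) (sumFin-const n (h zero)))) (sumPairs-ends n (h ∘ suc)) ⟩
    n * h zero + S + (n ∸ 1) * S
  ≡⟨ +-assoc (n * h zero) S _ ⟩
    n * h zero + (S + (n ∸ 1) * S)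
  ≡⟨ cong (n * h zero +_) (sumFin-+-pred n (h ∘ suc)) ⟩
    n * h zero + n * S
  ≡⟨ sym (*-distribˡ-+ n (h zero) S) ⟩
    n * (h zero + S) ∎
  where
  open ≡-Reasoning
  S = sumFin n (h ∘ suc)

sumTriples-suc : ∀ n (f : Fin (suc n) → Fin (suc n) → Fin (suc n) → ℕ) →
  sumTriples (suc n) f
    ≡ sumPairs n (λ j k → f zero (suc j) (suc k)) + sumTriples n (λ i j k → f (suc i) (suc j) (suc k))
sumTriples-suc n f = cong₂ _+_
  (cong (_+ sumPairs n (λ j k → f zero (suc j) (suc k))) (sumFin-zero n))
  (sumFin-cong n λ i → trans (cong (_+ sumFin n (inner i)) (sumFin-zero n))
    (sumFin-cong n λ j → cong (_+ sumFin n (innermost i j)) (if-eta (does (i <? j)))))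
  where
  innermost : Fin n → Fin n → Fin n → ℕ
  innermost i j k = if does (i <? j) then (if does (j <? k) then f (suc i) (suc j) (suc k) else 0) else 0
  inner : Fin n → Fin n → ℕ
  inner i j = sumFin (suc n) λ k →
    if does (suc i <? suc j) then (if does (suc j <? k) then f (suc i) (suc j) k else 0) else 0

sumTriples-mono : ∀ n {f g : Fin n → Fin n → Fin n → ℕ} → (∀ i j k → f i j k ≤ g i j k) →
  sumTriples n f ≤ sumTriples n g
sumTriples-mono n f≤g = sumFin-mono n λ i → sumFin-mono n λ j → sumFin-mono n λ k →
  if-mono (does (i <? j)) (if-mono (does (j <? k)) (f≤g i j k))

sumTriples-* : ∀ n c (f : Fin n → Fin n → Fin n → ℕ) →
  sumTriples n (λ i j k → c * f i j k) ≡ c * sumTriples n f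
sumTriples-* n c f = trans
  (sumFin-cong n λ i → trans (sumFin-cong n λ j → trans (sumFin-cong n λ k → guarded-* i j k) (sumFin-* n c _))
    (sumFin-* n c _))
  (sumFin-* n c _)
  where
  guarded-* : ∀ i j k → (if does (i <? j) then (if does (j <? k) then c * f i j k else 0) else 0)
                      ≡ c * (if does (i <? j) then (if does (j <? k) then f i j k else 0) else 0)
  guarded-* i j k = trans (cong (λ t → if does (i <? j) then t else 0) (if-* (does (j <? k)) c (f i j k)))
                          (if-* (does (i <? j)) c _)

guard-sorted : ∀ {n} {i j k : Fin n} (x : ℕ) → i < j → j < k →
  (if does (i <? j) then (if does (j <? k) then x else 0) else 0) ≡ x
guard-sorted {i = i} {j} {k} x i<j j<k rewrite dec-true (i <? j) i<j | dec-true (j <? k) j<k = refl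

sumTriples-tight : ∀ n {f g : Fin n → Fin n → Fin n → ℕ} → (∀ i j k → f i j k ≤ g i j k) →
  sumTriples n f ≡ sumTriples n g → ∀ {i j k} → i < j → j < k → f i j k ≡ g i j k
sumTriples-tight n {f} {g} f≤g eq {i} {j} {k} i<j j<k =
  trans (sym (guard-sorted _ i<j j<k)) (trans summands≡ (guard-sorted _ i<j j<k))
  where
  guarded≤ : ∀ i j k → (if does (i <? j) then (if does (j <? k) then f i j k else 0) else 0)
                     ≤ (if does (i <? j) then (if does (j <? k) then g i j k else 0) else 0)
  guarded≤ i j k = if-mono (does (i <? j)) (if-mono (does (j <? k)) (f≤g i j k))
  summands≡ = sumFin-tight n (guarded≤ i j) (sumFin-tight n (λ j → sumFin-mono n (guarded≤ i j))
    (sumFin-tight n (λ i → sumFin-mono n λ j → sumFin-mono n (guarded≤ i j)) eq i) j) k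

perimeter : ∀ {n} → (Fin n → Fin n → ℕ) → Fin n → Fin n → Fin n → ℕ
perimeter d i j k = d i j + d j k + d i k

sumTriples-perimeter : ∀ n (d : Fin n → Fin n → ℕ) → sumTriples n (perimeter d) ≡ (n ∸ 2) * sumPairs n d
sumTriples-perimeter zero    d = refl
sumTriples-perimeter (suc n) d = begin
    sumTriples (suc n) (perimeter d)
  ≡⟨ sumTriples-suc n (perimeter d) ⟩
    sumPairs n (λ j k → d zero (suc j) + d (suc j) (suc k) + d zero (suc k)) + sumTriples n (perimeter d′)
  ≡⟨ cong₂ _+_ (trans (sumPairs-cong n λ j k → rearrange (d zero (suc j)) _ _) (sumPairs-+ n _ d′))
               (sumTriples-perimeter n d′) ⟩
    sumPairs n (λ j k → h j + h k) + P + (n ∸ 2) * P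
  ≡⟨ cong (_+ (n ∸ 2) * P) (cong (_+ P) (sumPairs-ends n h)) ⟩
    (n ∸ 1) * sumFin n h + P + (n ∸ 2) * P
  ≡⟨ +-assoc ((n ∸ 1) * sumFin n h) P _ ⟩
    (n ∸ 1) * sumFin n h + (P + (n ∸ 2) * P)
  ≡⟨ cong ((n ∸ 1) * sumFin n h +_) (sumPairs-+-pred n d′) ⟩
    (n ∸ 1) * sumFin n h + (n ∸ 1) * P
  ≡⟨ sym (*-distribˡ-+ (n ∸ 1) (sumFin n h) P) ⟩
    (n ∸ 1) * (sumFin n h + P) ∎
  where
  open ≡-Reasoning
  d′ : Fin n → Fin n → ℕ
  d′ j k = d (suc j) (suc k)
  h : Fin n → ℕ
  h j = d zero (suc j)
  P = sumPairs n d′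
  rearrange : ∀ a b c → a + b + c ≡ a + c + b
  rearrange = solve-∀

module _ {n : ℕ} (P : Fin n → Fin n → Fin n → Set)
  (swap₁₂ : ∀ {x y z} → P x y z → P y x z) (swap₂₃ : ∀ {x y z} → P x y z → P x z y)
  (diagonal : ∀ x z → P x x z) (sorted : ∀ {x y z} → x < y → y < z → P x y z) where

  private
    first-smallest : ∀ {x y} z → x < y → P x y z
    first-smallest {x} {y} z x<y with <-cmp y z
    ... | tri< y<z _ _ = sorted x<y y<z
    ... | tri≈ _ refl _ = swap₁₂ (swap₂₃ (diagonal y x))
    ... | tri> _ _ z<y with <-cmp x z
    ...   | tri< x<z _ _ = swap₂₃ (sorted x<z z<y)
    ...   | tri≈ _ refl _ = swap₂₃ (diagonal x y)
    ...   | tri> _ _ z<x = swap₂₃ (swap₁₂ (sorted z<x x<y))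

  all-triples : ∀ x y z → P x y z
  all-triples x y z with <-cmp x y
  ... | tri< x<y _ _ = first-smallest z x<y
  ... | tri≈ _ refl _ = diagonal x z
  ... | tri> _ _ y<x = swap₁₂ (first-smallest z y<x)

-- Walks and paths

mapʷ : ∀ {n} {A B : Fin n → Fin n → Bool} → (∀ a b → T (A a b) → T (B a b)) →
  ∀ {u v k} → Walk A u v k → Walk B u v k
mapʷ A⊆B []                = []
mapʷ A⊆B (_∷_ {u} {x} e w) = A⊆B u x e ∷ mapʷ A⊆B w

module _ {n : ℕ} {A : Fin n → Fin n → Bool} where

  _++ʷ_ : ∀ {u v w k l} → Walk A u v k → Walk A v w l → Walk A u w (k + l)
  []      ++ʷ q = q
  (e ∷ p) ++ʷ q = e ∷ (p ++ʷ q)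

  reverseʷ : (∀ a b → A a b ≡ A b a) → ∀ {u v k} → Walk A u v k → Walk A v u k
  reverseʷ A-sym [] = []
  reverseʷ A-sym (_∷_ {u} {x} {k = k} e w) =
    subst (Walk A _ u) (+-comm k 1) (reverseʷ A-sym w ++ʷ (subst T (A-sym u x) e ∷ []))

  onWalk-[] : ∀ {m u} → OnWalk m ([] {A = A} {u}) → m ≡ u
  onWalk-[] (here _) = refl

  onWalk-∷ : ∀ {m u x v k} {e : T (A u x)} {w : Walk A x v k} → OnWalk m (e ∷ w) → m ≡ u ⊎ OnWalk m w
  onWalk-∷ (here _)      = inj₁ refl
  onWalk-∷ (there _ _ o) = inj₂ o

  onWalk? : ∀ (m : Fin n) {u v k} (w : Walk A u v k) → Dec (OnWalk m w)
  onWalk? m {u} w with m ≟ u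
  onWalk? m     w       | yes refl = yes (here w)
  onWalk? m     []      | no m≢u   = no (m≢u ∘ onWalk-[])
  onWalk? m     (e ∷ w) | no m≢u with onWalk? m w
  ... | yes o = yes (there e w o)
  ... | no ¬o = no ([ m≢u , ¬o ] ∘ onWalk-∷)

  onWalk-end : ∀ {u v k} (w : Walk A u v k) → OnWalk v w
  onWalk-end []      = here []
  onWalk-end (e ∷ w) = there e w (onWalk-end w)

  onWalk-join : ∀ {u v w k l} (p : Walk A u v k) (q : Walk A v w l) → OnWalk v (p ++ʷ q)
  onWalk-join []      q = here q
  onWalk-join (e ∷ p) q = there e (p ++ʷ q) (onWalk-join p q)

  prefixLength suffixLength : ∀ {m u v k} {w : Walk A u v k} → OnWalk m w → ℕ
  prefixLength (here _)      = 0
  prefixLength (there _ _ o) = suc (prefixLength o)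
  suffixLength (here {k = k} _) = k
  suffixLength (there _ _ o)    = suffixLength o

  prefix : ∀ {m u v k} {w : Walk A u v k} (o : OnWalk m w) → Walk A u m (prefixLength o)
  prefix (here _)      = []
  prefix (there e _ o) = e ∷ prefix o

  suffix : ∀ {m u v k} {w : Walk A u v k} (o : OnWalk m w) → Walk A m v (suffixLength o)
  suffix (here w)      = w
  suffix (there _ _ o) = suffix o

  prefix+suffix : ∀ {m u v k} {w : Walk A u v k} (o : OnWalk m w) → prefixLength o + suffixLength o ≡ k
  prefix+suffix (here _)      = refl
  prefix+suffix (there _ _ o) = cong suc (prefix+suffix o)

  IsPath : ∀ {u v k} → Walk A u v k → Set
  IsPath []            = ⊤
  IsPath (_∷_ {u} _ w) = ¬ OnWalk u w × IsPath w

  suffix-isPath : ∀ {m u v k} {w : Walk A u v k} (o : OnWalk m w) → IsPath w → IsPath (suffix o)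
  suffix-isPath (here _)      p       = p
  suffix-isPath (there _ _ o) (_ , p) = suffix-isPath o p

  record Path (u v : Fin n) : Set where
    constructor path
    field
      {len}  : ℕ
      walk   : Walk A u v len
      isPath : IsPath walk

  toPath : ∀ {u v k} → Walk A u v k → Path u v
  toPath []            = path [] tt
  toPath (_∷_ {u} e w) with toPath w
  ... | path p p-isPath with onWalk? u p
  ...   | yes u∈p = path (suffix u∈p) (suffix-isPath u∈p p-isPath)
  ...   | no  u∉p = path (e ∷ p) (u∉p , p-isPath)

  Avoids : (Fin n → Set) → ∀ {u v k} → Walk A u v k → Set
  Avoids B []            = ⊤
  Avoids B (_∷_ {u} _ w) = ¬ B u × Avoids B w

  record FirstHit (B : Fin n → Set) (z : Fin n) : Set where
    constructor firstHitAt
    field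
      {end}  : Fin n
      {len}  : ℕ
      walk   : Walk A z end len
      isPath : IsPath walk
      avoids : Avoids B walk
      hits   : B end

  -- The second component (the prefix stays on R) keeps the prefix a path in the recursive step.
  firstHit : (B : Fin n → Set) → (∀ y → Dec (B y)) → ∀ {z x k} (R : Walk A z x k) → IsPath R → B x →
    Σ (FirstHit B z) λ h → ∀ y → OnWalk y (FirstHit.walk h) → OnWalk y R
  firstHit B B? []            _            Bx = firstHitAt [] tt tt Bx , λ _ o → o
  firstHit B B? (_∷_ {z} e R) (z∉R , R-isPath) Bx with B? z | firstHit B B? R R-isPath Bx
  ... | yes Bz | _ = firstHitAt [] tt tt Bz , λ { y (here _) → here (e ∷ R) }
  ... | no ¬Bz | firstHitAt Q Q-isPath Q-avoids hit , Q⊆R =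
    firstHitAt (e ∷ Q) (z∉R ∘ Q⊆R z , Q-isPath) (¬Bz , Q-avoids) hit ,
    λ { y (here _) → here (e ∷ R) ; y (there _ _ o) → there e R (Q⊆R y o) }

-- Counting edges

∨-introˡ : ∀ b c → T b → T (b ∨ c)
∨-introˡ true c _ = _

∨-introʳ : ∀ b c → T c → T (b ∨ c)
∨-introʳ true  c _ = _
∨-introʳ false c t = t

𝟙 : Bool → ℕ
𝟙 b = if b then 1 else 0

𝟙-mono : ∀ {b c} → (T b → T c) → 𝟙 b ≤ 𝟙 c
𝟙-mono {false}         _   = z≤n
𝟙-mono {true} {true}   _   = ≤-refl
𝟙-mono {true} {false}  b⇒c = ⊥-elim (b⇒c _)

𝟙-∨ : ∀ b c → 𝟙 (b ∨ c) ≤ 𝟙 b + 𝟙 c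
𝟙-∨ false c = ≤-refl
𝟙-∨ true  c = s≤s z≤n

𝟙-∨-disjoint : ∀ b c → (T b → T c → ⊥) → 𝟙 (b ∨ c) ≡ 𝟙 b + 𝟙 c
𝟙-∨-disjoint false c     _ = refl
𝟙-∨-disjoint true  false _ = refl
𝟙-∨-disjoint true  true  ¬both = ⊥-elim (¬both _ _)

module _ {n : ℕ} where

  -- edgeCount H is pairCount (es H) by definition.
  pairCount : (Fin n → Fin n → Bool) → ℕ
  pairCount E = sumPairs n λ i j → 𝟙 (E i j)

  pairCount-∅ : pairCount (λ _ _ → false) ≡ 0
  pairCount-∅ =
    trans (sumFin-cong n λ i → trans (sumFin-cong n λ j → if-eta (does (i <? j))) (sumFin-zero n)) (sumFin-zero n)

  pairCount-mono : ∀ {E F : Fin n → Fin n → Bool} → (∀ i j → T (E i j) → T (F i j)) → pairCount E ≤ pairCount F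
  pairCount-mono E⊆F = sumPairs-mono n λ i j → 𝟙-mono (E⊆F i j)

  pairCount-cong : ∀ {E F : Fin n → Fin n → Bool} → (∀ i j → E i j ≡ F i j) → pairCount E ≡ pairCount F
  pairCount-cong E≗F = sumPairs-cong n λ i j → cong 𝟙 (E≗F i j)

  pairCount-∨ : ∀ (E F : Fin n → Fin n → Bool) → pairCount (λ i j → E i j ∨ F i j) ≤ pairCount E + pairCount F
  pairCount-∨ E F = ≤-trans (sumPairs-mono n λ i j → 𝟙-∨ (E i j) (F i j)) (≤-reflexive (sumPairs-+ n _ _))

  pairCount-∨-disjoint : ∀ (E F : Fin n → Fin n → Bool) → (∀ i j → T (E i j) → T (F i j) → ⊥) →
    pairCount (λ i j → E i j ∨ F i j) ≡ pairCount E + pairCount F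
  pairCount-∨-disjoint E F disjoint =
    trans (sumPairs-cong n λ i j → 𝟙-∨-disjoint (E i j) (F i j) (disjoint i j)) (sumPairs-+ n _ _)

  arc : Fin n → Fin n → Fin n → Fin n → Bool
  arc a b i j = does (i ≟ a) ∧ does (j ≟ b)

  link : Fin n → Fin n → Fin n → Fin n → Bool
  link a b i j = arc a b i j ∨ arc b a i j

  pairCount-arc : ∀ (a b : Fin n) → pairCount (arc a b) ≡ 𝟙 (does (a <? b))
  pairCount-arc a b = trans
    (sumFin-cong n λ i → trans (sumFin-cong n λ j → reorder (does (i <? j)) (does (i ≟ a)) (does (j ≟ b)))
      (sumFin-δ n b λ j → if does (i ≟ a) then 𝟙 (does (i <? j)) else 0))
    (sumFin-δ n a λ i → 𝟙 (does (i <? b)))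
    where
    reorder : ∀ p q r → (if p then 𝟙 (q ∧ r) else 0) ≡ (if r then (if q then 𝟙 p else 0) else 0)
    reorder p true  true  = refl
    reorder p true  false = if-eta p
    reorder p false true  = if-eta p
    reorder p false false = if-eta p

  arc-ends : ∀ a b i j → T (arc a b i j) → i ≡ a × j ≡ b
  arc-ends a b i j t with i ≟ a | j ≟ b
  ... | yes i≡a | yes j≡b = i≡a , j≡b
  ... | yes _   | no  _   = ⊥-elim t
  ... | no  _   | _       = ⊥-elim t

  exactly-one-< : ∀ {a b : Fin n} → a ≢ b → 𝟙 (does (a <? b)) + 𝟙 (does (b <? a)) ≡ 1
  exactly-one-< {a} {b} a≢b with <-cmp a b
  ... | tri< a<b _ b≮a rewrite dec-true (a <? b) a<b | dec-false (b <? a) b≮a = refl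
  ... | tri≈ _ a≡b _   = ⊥-elim (a≢b a≡b)
  ... | tri> a≮b _ b<a rewrite dec-false (a <? b) a≮b | dec-true (b <? a) b<a = refl

  pairCount-link : ∀ {a b : Fin n} → a ≢ b → pairCount (link a b) ≡ 1
  pairCount-link {a} {b} a≢b = begin
      pairCount (link a b)
    ≡⟨ pairCount-∨-disjoint (arc a b) (arc b a) disjoint ⟩
      pairCount (arc a b) + pairCount (arc b a)
    ≡⟨ cong₂ _+_ (pairCount-arc a b) (pairCount-arc b a) ⟩
      𝟙 (does (a <? b)) + 𝟙 (does (b <? a))
    ≡⟨ exactly-one-< a≢b ⟩
      1 ∎
    where
    open ≡-Reasoning
    disjoint : ∀ i j → T (arc a b i j) → T (arc b a i j) → ⊥
    disjoint i j ab ba = a≢b (trans (sym (proj₁ (arc-ends a b i j ab))) (proj₁ (arc-ends b a i j ba)))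

  pairCount-link-≤ : ∀ (a b : Fin n) → pairCount (link a b) ≤ 1
  pairCount-link-≤ a b with a ≟ b
  ... | no a≢b = ≤-reflexive (pairCount-link a≢b)
  ... | yes refl = ≤-trans (pairCount-∨ (arc a a) (arc a a))
    (≤-trans (≤-reflexive (cong₂ _+_ (pairCount-arc a a) (pairCount-arc a a))) never)
    where
    never : 𝟙 (does (a <? a)) + 𝟙 (does (a <? a)) ≤ 1
    never rewrite dec-false (a <? a) (<-irrefl refl) = z≤n

  link-ends : ∀ a b i j → T (link a b i j) → (i ≡ a × j ≡ b) ⊎ (i ≡ b × j ≡ a)
  link-ends a b i j t with Equivalence.to T-∨ t
  ... | inj₁ ab = inj₁ (arc-ends a b i j ab)
  ... | inj₂ ba = inj₂ (arc-ends b a i j ba)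

  link-self : ∀ a b → T (link a b a b)
  link-self a b rewrite dec-true (a ≟ a) refl | dec-true (b ≟ b) refl = _

  link-sym : ∀ a b i j → link a b i j ≡ link a b j i
  link-sym a b i j = trans (∨-comm (arc a b i j) (arc b a i j))
    (cong₂ _∨_ (∧-comm (does (i ≟ b)) (does (j ≟ a))) (∧-comm (does (i ≟ a)) (does (j ≟ b))))

module _ {n : ℕ} {A : Fin n → Fin n → Bool} where

  edgesOf : ∀ {u v k} → Walk A u v k → Fin n → Fin n → Bool
  edgesOf []                _ _ = false
  edgesOf (_∷_ {u} {x} _ w) i j = link u x i j ∨ edgesOf w i j

  edgesOf-sym : ∀ {u v k} (w : Walk A u v k) i j → edgesOf w i j ≡ edgesOf w j i
  edgesOf-sym []                i j = refl
  edgesOf-sym (_∷_ {u} {x} _ w) i j = cong₂ _∨_ (link-sym u x i j) (edgesOf-sym w i j)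

  edgesOf-ends : ∀ {u v k} (w : Walk A u v k) i j → T (edgesOf w i j) → OnWalk i w × OnWalk j w
  edgesOf-ends (_∷_ {u} {x} e w) i j t with Equivalence.to T-∨ t
  ... | inj₂ t′ = let (i∈w , j∈w) = edgesOf-ends w i j t′ in there e w i∈w , there e w j∈w
  ... | inj₁ l with link-ends u x i j l
  ...   | inj₁ (refl , refl) = here (e ∷ w) , there e w (here w)
  ...   | inj₂ (refl , refl) = there e w (here w) , here (e ∷ w)

  edgesOf-⊆ : (∀ a b → A a b ≡ A b a) → ∀ {u v k} (w : Walk A u v k) i j → T (edgesOf w i j) → T (A i j)
  edgesOf-⊆ A-sym (_∷_ {u} {x} e w) i j t with Equivalence.to T-∨ t
  ... | inj₂ t′ = edgesOf-⊆ A-sym w i j t′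
  ... | inj₁ l with link-ends u x i j l
  ...   | inj₁ (refl , refl) = e
  ...   | inj₂ (refl , refl) = subst T (A-sym u x) e

  toEdgesOf : ∀ {u v k} (w : Walk A u v k) → Walk (edgesOf w) u v k
  toEdgesOf []                = []
  toEdgesOf (_∷_ {u} {x} e w) =
    ∨-introˡ _ _ (link-self u x) ∷ mapʷ (λ a b → ∨-introʳ (link u x a b) _) (toEdgesOf w)

  edgesOf-suffix-⊆ : ∀ {m u v k} {w : Walk A u v k} (o : OnWalk m w) i j →
    T (edgesOf (suffix o) i j) → T (edgesOf w i j)
  edgesOf-suffix-⊆ (here _)      i j t = t
  edgesOf-suffix-⊆ (there {u} {x} _ _ o) i j t = ∨-introʳ (link u x i j) _ (edgesOf-suffix-⊆ o i j t)

  pairCount-edgesOf-≤ : ∀ {u v k} (w : Walk A u v k) → pairCount (edgesOf w) ≤ k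
  pairCount-edgesOf-≤ []                = ≤-reflexive (pairCount-∅ {n})
  pairCount-edgesOf-≤ (_∷_ {u} {x} _ w) =
    ≤-trans (pairCount-∨ (link u x) (edgesOf w)) (+-mono-≤ (pairCount-link-≤ u x) (pairCount-edgesOf-≤ w))

  pairCount-path-∨ : (B : Fin n → Set) (F : Fin n → Fin n → Bool) → (∀ i j → T (F i j) → B i × B j) →
    ∀ {u v k} (Q : Walk A u v k) → IsPath Q → Avoids B Q →
    pairCount (λ i j → edgesOf Q i j ∨ F i j) ≡ k + pairCount F
  pairCount-path-∨ B F F⊆B []                _              _ = refl
  pairCount-path-∨ B F F⊆B (_∷_ {u} {x} {k = k} e Q) (u∉Q , Q-isPath) (¬Bu , Q-avoids) = begin
      pairCount (λ i j → (link u x i j ∨ edgesOf Q i j) ∨ F i j)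
    ≡⟨ pairCount-cong (λ i j → ∨-assoc (link u x i j) _ _) ⟩
      pairCount (λ i j → link u x i j ∨ (edgesOf Q i j ∨ F i j))
    ≡⟨ pairCount-∨-disjoint (link u x) _ fresh ⟩
      pairCount (link u x) + pairCount (λ i j → edgesOf Q i j ∨ F i j)
    ≡⟨ cong₂ _+_ (pairCount-link u≢x) (pairCount-path-∨ B F F⊆B Q Q-isPath Q-avoids) ⟩
      suc (k + pairCount F) ∎
    where
    open ≡-Reasoning
    u≢x : u ≢ x
    u≢x refl = u∉Q (here Q)
    avoids-u : ∀ i j → T (edgesOf Q i j ∨ F i j) → i ≢ u × j ≢ u
    avoids-u i j t with Equivalence.to T-∨ t
    ... | inj₁ inQ = let (i∈Q , j∈Q) = edgesOf-ends Q i j inQ in (λ { refl → u∉Q i∈Q }) , (λ { refl → u∉Q j∈Q })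
    ... | inj₂ inF = let (Bi , Bj) = F⊆B i j inF in (λ { refl → ¬Bu Bi }) , (λ { refl → ¬Bu Bj })
    fresh : ∀ i j → T (link u x i j) → T (edgesOf Q i j ∨ F i j) → ⊥
    fresh i j l rest with link-ends u x i j l | avoids-u i j rest
    ... | inj₁ (i≡u , _) | i≢u , _ = i≢u i≡u
    ... | inj₂ (_ , j≡u) | _ , j≢u = j≢u j≡u

  pairCount-path : ∀ {u v k} (P : Walk A u v k) → IsPath P → pairCount (edgesOf P) ≡ k
  pairCount-path {k = k} P P-isPath = begin
      pairCount (edgesOf P)
    ≡⟨ pairCount-cong (λ i j → sym (∨-identityʳ (edgesOf P i j))) ⟩
      pairCount (λ i j → edgesOf P i j ∨ false)
    ≡⟨ pairCount-path-∨ (λ _ → ⊥) (λ _ _ → false) (λ _ _ ()) P P-isPath (avoids-nothing P) ⟩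
      k + pairCount {n} (λ _ _ → false)
    ≡⟨ cong (k +_) (pairCount-∅ {n}) ⟩
      k + 0
    ≡⟨ +-identityʳ k ⟩
      k ∎
    where
    open ≡-Reasoning
    avoids-nothing : ∀ {u v k} (w : Walk A u v k) → Avoids (λ _ → ⊥) w
    avoids-nothing []      = tt
    avoids-nothing (_ ∷ w) = (λ ()) , avoids-nothing w

-- Subgraphs

module _ {n : ℕ} {G : Graph n} where

  hub-connected : (H : Subgraph G) (m : Fin n) → (∀ i → T (vs H i) → ∃ λ k → Walk (es H) i m k) → SubConnected H
  hub-connected H m reach i j i∈H j∈H =
    let (k , i⇝m) = reach i i∈H ; (l , j⇝m) = reach j j∈H in k + l , i⇝m ++ʷ reverseʷ (es-sym H) j⇝m

  _∪_ : Subgraph G → Subgraph G → Subgraph G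
  H ∪ K = record
    { vs     = λ i → vs H i ∨ vs K i
    ; es     = λ i j → es H i j ∨ es K i j
    ; es-sym = λ i j → cong₂ _∨_ (es-sym H i j) (es-sym K i j)
    ; es-sub = λ i j t → [ es-sub H i j , es-sub K i j ] (Equivalence.to T-∨ t)
    ; es-end = λ i j t → [ ∨-introˡ _ _ ∘ es-end H i j , ∨-introʳ (vs H i) _ ∘ es-end K i j ] (Equivalence.to T-∨ t)
    }

  edgeCount-∪ : ∀ (H K : Subgraph G) → edgeCount (H ∪ K) ≤ edgeCount H + edgeCount K
  edgeCount-∪ H K = pairCount-∨ (es H) (es K)

  disjoint-paths-≤-edgeCount : ∀ (H : Subgraph G) {x y z c a b}
    (P : Walk (es H) x y a) → IsPath P → (Q : Walk (es H) z c b) → IsPath Q → Avoids (λ t → OnWalk t P) Q →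
    b + a ≤ edgeCount H
  disjoint-paths-≤-edgeCount H {a = a} {b} P P-isPath Q Q-isPath Q-avoids = begin
      b + a
    ≡⟨ sym (trans (pairCount-path-∨ (λ t → OnWalk t P) (edgesOf P) (edgesOf-ends P) Q Q-isPath Q-avoids)
                  (cong (b +_) (pairCount-path P P-isPath))) ⟩
      pairCount (λ i j → edgesOf Q i j ∨ edgesOf P i j)
    ≤⟨ pairCount-mono (λ i j t → [ edgesOf-⊆ (es-sym H) Q i j , edgesOf-⊆ (es-sym H) P i j ] (Equivalence.to T-∨ t)) ⟩
      edgeCount H ∎
    where open ≤-Reasoning

  ∪-connected : ∀ (H K : Subgraph G) {m} → SubConnected H → SubConnected K → T (vs H m) → T (vs K m) →
    SubConnected (H ∪ K)
  ∪-connected H K {m} H-conn K-conn m∈H m∈K = hub-connected (H ∪ K) m reach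
    where
    reach : ∀ i → T (vs (H ∪ K) i) → ∃ λ k → Walk (es (H ∪ K)) i m k
    reach i i∈H∪K with Equivalence.to T-∨ i∈H∪K
    ... | inj₁ i∈H = let (k , w) = H-conn i m i∈H m∈H in k , mapʷ (λ a b → ∨-introˡ _ _) w
    ... | inj₂ i∈K = let (k , w) = K-conn i m i∈K m∈K in k , mapʷ (λ a b → ∨-introʳ (es H a b) _) w

module _ {n : ℕ} (G : Graph n) where

  walkSubgraph : ∀ {u v k} → Walk (adj G) u v k → Subgraph G
  walkSubgraph w = record
    { vs     = λ i → isYes (onWalk? i w)
    ; es     = edgesOf w
    ; es-sym = edgesOf-sym w
    ; es-sub = edgesOf-⊆ (Graph.sym G) w
    ; es-end = λ i j t → fromWitness (proj₁ (edgesOf-ends w i j t))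
    }

  walkSubgraph-connected : ∀ {u v k} (w : Walk (adj G) u v k) → SubConnected (walkSubgraph w)
  walkSubgraph-connected w = hub-connected (walkSubgraph w) _ λ i i∈w →
    let o = toWitness i∈w in suffixLength o , mapʷ (edgesOf-suffix-⊆ o) (toEdgesOf (suffix o))

  walkSubgraph-start : ∀ {u v k} (w : Walk (adj G) u v k) → T (vs (walkSubgraph w) u)
  walkSubgraph-start w = fromWitness (here w)

  walkSubgraph-end : ∀ {u v k} (w : Walk (adj G) u v k) → T (vs (walkSubgraph w) v)
  walkSubgraph-end w = fromWitness (onWalk-end w)

  edgeCount-walkSubgraph : ∀ {u v k} (w : Walk (adj G) u v k) → edgeCount (walkSubgraph w) ≤ k
  edgeCount-walkSubgraph = pairCount-edgesOf-≤

-- Distances, intervals and Steiner distances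

module _ {n : ℕ} (G : Graph n) {d : Fin n → Fin n → ℕ} (isDist : ∀ u v → IsDist G u v (d u v)) where

  geodesic : ∀ u v → Walk (adj G) u v (d u v)
  geodesic u v = proj₁ (isDist u v)

  dist-≤ : ∀ {u v k} → Walk (adj G) u v k → d u v ≤ k
  dist-≤ {u} {v} {k} = proj₂ (isDist u v) k

  dist-sym : ∀ u v → d u v ≡ d v u
  dist-sym u v = ≤-antisym (dist-≤ (reverseʷ (Graph.sym G) (geodesic v u)))
                           (dist-≤ (reverseʷ (Graph.sym G) (geodesic u v)))

  dist-triangle : ∀ u m v → d u v ≤ d u m + d m v
  dist-triangle u m v = dist-≤ (geodesic u m ++ʷ geodesic m v)

  dist-refl : ∀ u → d u u ≡ 0
  dist-refl u = n≤0⇒n≡0 (dist-≤ ([] {u = u}))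

  inInterval⇔ : ∀ {u v m} → InInterval G u v m ⇔ (d u m + d m v ≡ d u v)
  inInterval⇔ {u} {v} {m} = mk⇔ to from
    where
    to : InInterval G u v m → d u m + d m v ≡ d u v
    to (k , w , m∈w , shortest) = ≤-antisym (begin
        d u m + d m v                        ≤⟨ +-mono-≤ (dist-≤ (prefix m∈w)) (dist-≤ (suffix m∈w)) ⟩
        prefixLength m∈w + suffixLength m∈w  ≡⟨ prefix+suffix m∈w ⟩
        k                                    ≤⟨ shortest (d u v) (geodesic u v) ⟩
        d u v                                ∎) (dist-triangle u m v)
      where open ≤-Reasoning
    from : d u m + d m v ≡ d u v → InInterval G u v m
    from split = d u m + d m v , geodesic u m ++ʷ geodesic m v , onWalk-join (geodesic u m) (geodesic m v) ,
      λ k w → subst (_≤ k) (sym split) (dist-≤ w)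

  inInterval-legs⇔ : ∀ {u v c} → InInterval G u v c ⇔ (d u c + d v c ≡ d u v)
  inInterval-legs⇔ {u} {v} {c} = mk⇔
    (λ c∈I → trans flip-leg (Equivalence.to inInterval⇔ c∈I))
    (λ legs → Equivalence.from inInterval⇔ (trans (sym flip-leg) legs))
    where
    flip-leg : d u c + d v c ≡ d u c + d c v
    flip-leg = cong (d u c +_) (dist-sym v c)

  inInterval-sym : ∀ {u v m} → InInterval G u v m → InInterval G v u m
  inInterval-sym {u} {v} {m} m∈I = Equivalence.from inInterval-legs⇔
    (trans (+-comm (d v m) (d u m)) (trans (Equivalence.to inInterval-legs⇔ m∈I) (dist-sym u v)))

  inInterval-start : ∀ {u v} → InInterval G u v u
  inInterval-start {u} {v} = Equivalence.from inInterval⇔ (cong (_+ d u v) (dist-refl u))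

  Median : Fin n → Fin n → Fin n → Fin n → Set
  Median x y z m = InInterval G x y m × InInterval G x z m × InInterval G y z m

  median-swap₁₂ : ∀ {x y z m} → Median x y z m → Median y x z m
  median-swap₁₂ (xy , xz , yz) = inInterval-sym xy , yz , xz

  median-swap₂₃ : ∀ {x y z m} → Median x y z m → Median x z y m
  median-swap₂₃ (xy , xz , yz) = xz , xy , inInterval-sym yz

  median-diagonal : ∀ x z → Median x x z x
  median-diagonal x z = inInterval-start , inInterval-start , inInterval-start

  tripod : Fin n → Fin n → Fin n → Fin n → ℕ
  tripod x y z c = d x c + d y c + d z c

  private
    legs-sum : ∀ a b c → (a + b) + (b + c) + (a + c) ≡ 2 * (a + b + c)
    legs-sum = solve-∀

    triangle : ∀ u v c → d u v ≤ d u c + d v c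
    triangle u v c = subst (d u v ≤_) (cong (d u c +_) (dist-sym c v)) (dist-triangle u c v)

  perimeter≤2*tripod : ∀ x y z c → perimeter d x y z ≤ 2 * tripod x y z c
  perimeter≤2*tripod x y z c = ≤-trans
    (+-mono-≤ (+-mono-≤ (triangle x y c) (triangle y z c)) (triangle x z c))
    (≤-reflexive (legs-sum (d x c) (d y c) (d z c)))

  perimeter≡2*tripod⇒median : ∀ {x y z c} → perimeter d x y z ≡ 2 * tripod x y z c → Median x y z c
  perimeter≡2*tripod⇒median {x} {y} {z} {c} eq =
    let (xy+yz , xz) = +-mono-≤-tight (+-mono-≤ (triangle x y c) (triangle y z c)) (triangle x z c)
                                      (trans eq (sym (legs-sum (d x c) (d y c) (d z c))))
        (xy , yz)    = +-mono-≤-tight (triangle x y c) (triangle y z c) xy+yz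
    in from (sym xy) , from (sym xz) , from (sym yz)
    where
    from : ∀ {u v} → d u c + d v c ≡ d u v → InInterval G u v c
    from = Equivalence.from inInterval-legs⇔

  median⇒perimeter≡2*tripod : ∀ {x y z c} → Median x y z c → perimeter d x y z ≡ 2 * tripod x y z c
  median⇒perimeter≡2*tripod {x} {y} {z} {c} (xy , xz , yz) =
    trans (cong₂ _+_ (cong₂ _+_ (legs xy) (legs yz)) (legs xz)) (legs-sum (d x c) (d y c) (d z c))
    where
    legs : ∀ {u v} → InInterval G u v c → d u v ≡ d u c + d v c
    legs = sym ∘ Equivalence.to inInterval-legs⇔

  tripod-≤-edgeCount : ∀ {x y z} (H : Subgraph G) → SubConnected H → ContainsTriple H x y z →
    ∃ λ c → tripod x y z c ≤ edgeCount H
  tripod-≤-edgeCount {x} {y} {z} H H-conn (x∈H , y∈H , z∈H) = c , (begin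
      d x c + d y c + d z c
    ≤⟨ +-mono-≤ (+-mono-≤ (dist-≤ (inG (prefix c∈P)))
                          (subst (_≤ suffixLength c∈P) (dist-sym c y) (dist-≤ (inG (suffix c∈P)))))
                (dist-≤ (inG Q)) ⟩
      prefixLength c∈P + suffixLength c∈P + FirstHit.len hit
    ≡⟨ cong (_+ FirstHit.len hit) (prefix+suffix c∈P) ⟩
      Path.len P + FirstHit.len hit
    ≡⟨ +-comm (Path.len P) _ ⟩
      FirstHit.len hit + Path.len P
    ≤⟨ disjoint-paths-≤-edgeCount H (Path.walk P) (Path.isPath P) Q (FirstHit.isPath hit) (FirstHit.avoids hit) ⟩
      edgeCount H ∎)
    where
    open ≤-Reasoning
    inG : ∀ {u v k} → Walk (es H) u v k → Walk (adj G) u v k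
    inG = mapʷ (es-sub H)
    P : Path {A = es H} x y
    P = toPath (proj₂ (H-conn x y x∈H y∈H))
    R : Path {A = es H} z x
    R = toPath (proj₂ (H-conn z x z∈H x∈H))
    hit : FirstHit (λ t → OnWalk t (Path.walk P)) z
    hit = proj₁ (firstHit (λ t → OnWalk t (Path.walk P)) (λ t → onWalk? t (Path.walk P))
                          (Path.walk R) (Path.isPath R) (here (Path.walk P)))
    c = FirstHit.end hit
    Q = FirstHit.walk hit
    c∈P = FirstHit.hits hit

  star : ∀ x y z m → Σ (Subgraph G) λ H → SubConnected H × ContainsTriple H x y z × edgeCount H ≤ tripod x y z m
  star x y z m = (W x ∪ W y) ∪ W z , connected , contains , count
    where
    W : Fin n → Subgraph G
    W u = walkSubgraph G (geodesic u m)
    connected : SubConnected ((W x ∪ W y) ∪ W z)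
    connected = ∪-connected (W x ∪ W y) (W z)
      (∪-connected (W x) (W y) (walkSubgraph-connected G _) (walkSubgraph-connected G _)
                   (walkSubgraph-end G (geodesic x m)) (walkSubgraph-end G (geodesic y m)))
      (walkSubgraph-connected G _)
      (∨-introˡ _ _ (walkSubgraph-end G (geodesic x m))) (walkSubgraph-end G (geodesic z m))
    contains : ContainsTriple ((W x ∪ W y) ∪ W z) x y z
    contains = ∨-introˡ _ _ (∨-introˡ _ _ (walkSubgraph-start G (geodesic x m))) ,
               ∨-introˡ _ _ (∨-introʳ (vs (W x) y) _ (walkSubgraph-start G (geodesic y m))) ,
               ∨-introʳ (vs (W x) z ∨ vs (W y) z) _ (walkSubgraph-start G (geodesic z m))
    count : edgeCount ((W x ∪ W y) ∪ W z) ≤ tripod x y z m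
    count = ≤-trans (edgeCount-∪ (W x ∪ W y) (W z))
      (+-mono-≤ (≤-trans (edgeCount-∪ (W x) (W y)) (+-mono-≤ (edgeCount-walkSubgraph G (geodesic x m))
                                                             (edgeCount-walkSubgraph G (geodesic y m))))
                (edgeCount-walkSubgraph G (geodesic z m)))

  steiner-≥-tripod : ∀ {x y z s} → IsSteinerDist G x y z s → ∃ λ c → tripod x y z c ≤ s
  steiner-≥-tripod ((H , H-conn , xyz∈H , |H|≡s) , _) =
    let (c , tripod≤|H|) = tripod-≤-edgeCount H H-conn xyz∈H in c , subst (_ ≤_) |H|≡s tripod≤|H|

  perimeter≤2*steiner : ∀ {x y z s} → IsSteinerDist G x y z s → perimeter d x y z ≤ 2 * s
  perimeter≤2*steiner {x} {y} {z} steiner =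
    let (c , tripod≤s) = steiner-≥-tripod steiner in
    ≤-trans (perimeter≤2*tripod x y z c) (*-monoʳ-≤ 2 tripod≤s)

  perimeter≡2*steiner⇒median : ∀ {x y z s} → IsSteinerDist G x y z s → perimeter d x y z ≡ 2 * s →
    ∃ (Median x y z)
  perimeter≡2*steiner⇒median {x} {y} {z} steiner tight =
    let (c , tripod≤s) = steiner-≥-tripod steiner in
    c , perimeter≡2*tripod⇒median (≤-antisym (perimeter≤2*tripod x y z c)
                                              (subst (2 * tripod x y z c ≤_) (sym tight) (*-monoʳ-≤ 2 tripod≤s)))

  median⇒2*steiner≤perimeter : ∀ {x y z s} → IsSteinerDist G x y z s → ∃ (Median x y z) → 2 * s ≤ perimeter d x y z
  median⇒2*steiner≤perimeter {x} {y} {z} {s} (_ , minimal) (m , median) =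
    let (H , H-conn , xyz∈H , |H|≤tripod) = star x y z m in
    subst (2 * s ≤_) (sym (median⇒perimeter≡2*tripod median))
          (*-monoʳ-≤ 2 (≤-trans (minimal H H-conn xyz∈H) |H|≤tripod))

mainTheorem1 : (n : ℕ) (G : Graph n) → Connected G →
    (d : Fin n → Fin n → ℕ) → (∀ u v → IsDist G u v (d u v)) →
    (sd : Fin n → Fin n → Fin n → ℕ) → (∀ x y z → IsSteinerDist G x y z (sd x y z)) →
    ((n ∸ 2) * Wiener n d ≤ 2 * SteinerWiener3 n sd)
    × ((2 * SteinerWiener3 n sd ≡ (n ∸ 2) * Wiener n d) ⇔ Modular G)
mainTheorem1 n G _ d isDist sd isSteiner = lower-bound , mk⇔ equality⇒modular modular⇒equality
  where
  open ≤-Reasoning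
  pointwise : ∀ i j k → perimeter d i j k ≤ 2 * sd i j k
  pointwise i j k = perimeter≤2*steiner G isDist (isSteiner i j k)

  lower-bound : (n ∸ 2) * Wiener n d ≤ 2 * SteinerWiener3 n sd
  lower-bound = begin
    (n ∸ 2) * Wiener n d                        ≡⟨ sumTriples-perimeter n d ⟨
    sumTriples n (perimeter d)                  ≤⟨ sumTriples-mono n pointwise ⟩
    sumTriples n (λ i j k → 2 * sd i j k)       ≡⟨ sumTriples-* n 2 sd ⟩
    2 * SteinerWiener3 n sd                     ∎

  equality⇒modular : 2 * SteinerWiener3 n sd ≡ (n ∸ 2) * Wiener n d → Modular G
  equality⇒modular tight = all-triples (λ x y z → ∃ (Median G isDist x y z))
    (λ (m , med) → m , median-swap₁₂ G isDist med) (λ (m , med) → m , median-swap₂₃ G isDist med)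
    (λ x z → x , median-diagonal G isDist x z)
    (λ i<j j<k → perimeter≡2*steiner⇒median G isDist (isSteiner _ _ _) (sumTriples-tight n pointwise sums i<j j<k))
    where
    sums : sumTriples n (perimeter d) ≡ sumTriples n (λ i j k → 2 * sd i j k)
    sums = trans (sumTriples-perimeter n d) (trans (sym tight) (sym (sumTriples-* n 2 sd)))

  modular⇒equality : Modular G → 2 * SteinerWiener3 n sd ≡ (n ∸ 2) * Wiener n d
  modular⇒equality modular = ≤-antisym (begin
    2 * SteinerWiener3 n sd                     ≡⟨ sumTriples-* n 2 sd ⟨
    sumTriples n (λ i j k → 2 * sd i j k)       ≤⟨ sumTriples-mono n pointwise-modular ⟩
    sumTriples n (perimeter d)                  ≡⟨ sumTriples-perimeter n d ⟩
    (n ∸ 2) * Wiener n d                        ∎) lower-bound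
    where
    pointwise-modular : ∀ i j k → 2 * sd i j k ≤ perimeter d i j k
    pointwise-modular i j k = median⇒2*steiner≤perimeter G isDist (isSteiner i j k) (modular i j k)
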